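{- The Magnet Rule generalizes the Domination Rule: for every Vertex Cover instance $(G,k)$ and every instance $(G',k')$ obtainable from $(G,k)$ by one application of the Domination Rule, one application of the Magnet Rule to $(G,k)$ yields an instance $(G'',k')$ with $G''$ isomorphic to $G'$.
   Context: Instances are pairs $(G,k)$ with $G$ a simple undirected graph and $k$ an integer (Vertex Cover). $N(x)$, $N[x]$ denote open and closed neighborhoods. Domination Rule: if $u,v$ are adjacent vertices with $N[v]\subseteq N[u]$, delete $u$ and decrease $k$ by one. Magnet Rule: let $a,b$ be adjacent vertices, $A=N(a)\setminus N[b]$, $B=N(b)\setminus N[a]$, $C=N(a)\cap N(b)$; if every vertex of $A$ is adjacent to every vertex of $B$, remove $a$ and $b$, create a new vertex $c$ adjacent to exactly the vertices of $C$, and decrease $k$ by one. -}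

module Defs where

open import Data.Nat using (ℕ)
open import Data.Fin using (Fin)
open import Data.Integer using (ℤ; _-_; 1ℤ)
open import Data.Empty using (⊥)
open import Data.Maybe using (Maybe; just; nothing)
open import Data.Product using (Σ; _×_; _,_; proj₁; proj₂)
open import Data.Sum using (_⊎_)
open import Relation.Nullary using (¬_)
open import Relation.Binary.PropositionalEquality using (_≡_; _≢_)
open import Function.Bundles using (_⤖_; _⇔_; Bijection)

record Graph (V : Set) : Set₁ where
  field
    _~_   : V → V → Set
    ~-sym : ∀ {x y} → x ~ y → y ~ x
    ~-irr : ∀ {x} → ¬ (x ~ x)
open Graph public

record Instance : Set₁ where
  constructor ⟨_,_,_⟩
  field
    V  : Set
    G  : Graph V
    k  : ℤ
open Instance public

N : ∀ {V} → Graph V → V → V → Set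
N G x y = _~_ G x y

N[_] : ∀ {V} → Graph V → V → V → Set
N[ G ] x y = (y ≡ x) ⊎ _~_ G x y

_≅_ : ∀ {V W} → Graph V → Graph W → Set
_≅_ {V} {W} G H =
  Σ (V ⤖ W) λ f → ∀ x y → (_~_ G x y ⇔ _~_ H (Bijection.to f x) (Bijection.to f y))

delete : ∀ {V} → Graph V → (u : V) → Graph (Σ V λ x → x ≢ u)
delete G u = record
  { _~_ = λ x y → _~_ G (proj₁ x) (proj₁ y)
  ; ~-sym = ~-sym G
  ; ~-irr = ~-irr G }

data DomStep : Instance → Instance → Set₁ where
  dom : ∀ {V} (G : Graph V) (k : ℤ) (u v : V) →
        _~_ G u v →
        (∀ w → N[ G ] v w → N[ G ] u w) →
        DomStep ⟨ V , G , k ⟩ ⟨ (Σ V λ x → x ≢ u) , delete G u , k - 1ℤ ⟩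

module _ {V : Set} (G : Graph V) (a b : V) where
  private _≈_ = _~_ G

  SetA SetB SetC : V → Set
  SetA y = N G a y × ¬ N[ G ] b y
  SetB y = N G b y × ¬ N[ G ] a y
  SetC y = N G a y × N G b y

  MagnetCond : Set
  MagnetCond = ∀ x y → SetA x → SetB y → x ≈ y

  -- vertices of the new graph: V \ {a,b} plus a fresh vertex c (= nothing)
  MV : Set
  MV = Maybe (Σ V λ x → (x ≢ a) × (x ≢ b))

  MAdj : MV → MV → Set
  MAdj (just x) (just y) = proj₁ x ≈ proj₁ y
  MAdj nothing  (just y) = SetC (proj₁ y)
  MAdj (just x) nothing  = SetC (proj₁ x)
  MAdj nothing  nothing  = ⊥

  MAdj-sym : ∀ {x y} → MAdj x y → MAdj y x
  MAdj-sym {just x} {just y} p = ~-sym G p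
  MAdj-sym {nothing} {just y} p = p
  MAdj-sym {just x} {nothing} p = p

  MAdj-irr : ∀ {x} → ¬ MAdj x x
  MAdj-irr {just x} p = ~-irr G p
  MAdj-irr {nothing} ()

  magnet : Graph MV
  magnet = record { _~_ = MAdj ; ~-sym = λ {x} {y} → MAdj-sym {x} {y} ; ~-irr = λ {x} → MAdj-irr {x} }

data MagnetStep : Instance → Instance → Set₁ where
  mag : ∀ {V} (G : Graph V) (k : ℤ) (a b : V) →
        _~_ G a b →
        MagnetCond G a b →
        MagnetStep ⟨ V , G , k ⟩ ⟨ MV G a b , magnet G a b , k - 1ℤ ⟩

-- If N[v] ⊆ N[u] for an edge uv, then B = N(v) \ N[u] is empty, so the Magnet condition
-- holds vacuously for the pair (u, v).  Moreover N(v) \ {u} ⊆ N(u) makes the merged vertex c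
-- adjacent to exactly the neighbours of v other than u, so sending c to v identifies the
-- magnet graph with G - u.
module Submission where

open import Defs
open import Data.Nat using (ℕ)
open import Data.Fin using (Fin; _≟_)
open import Data.Integer using (ℤ)
open import Data.Product using (Σ; _×_; _,_; proj₂)
open import Data.Sum using (inj₁; inj₂)
open import Data.Maybe using (just; nothing)
open import Data.Empty using (⊥-elim)
open import Relation.Nullary using (yes; no; contradiction)
open import Relation.Binary.Definitions using (DecidableEquality)
open import Relation.Binary.PropositionalEquality using (_≡_; _≢_; refl)
open import Function.Bundles using (_⤖_; _⇔_; mk↔ₛ′; mk⇔)
open import Function.Properties.Inverse using (↔⇒⤖)

adjacent⇒≢ : ∀ {V} (G : Graph V) {x y : V} → _~_ G x y → y ≢ x
adjacent⇒≢ G x~y refl = ~-irr G x~y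

Dominates : ∀ {V} → Graph V → V → V → Set
Dominates G u v = ∀ w → N[ G ] v w → N[ G ] u w

module _ {V : Set} (G : Graph V) {u v : V} (u≽v : Dominates G u v) where

  dominates⇒magnetCond : MagnetCond G u v
  dominates⇒magnetCond _ y _ (v~y , y∉N[u]) = contradiction (u≽v y (inj₂ v~y)) y∉N[u]

  dominates⇒neighbour : ∀ {y} → y ≢ u → _~_ G v y → _~_ G u y
  dominates⇒neighbour {y} y≢u v~y with u≽v y (inj₂ v~y)
  ... | inj₁ y≡u = contradiction y≡u y≢u
  ... | inj₂ u~y = u~y

module Merge {V : Set} (_≟_ : DecidableEquality V) (G : Graph V) {u v : V} (v≢u : v ≢ u) where

  toDeleted : MV G u v → Σ V (_≢ u)
  toDeleted (just (x , x≢u , _)) = x , x≢u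
  toDeleted nothing              = v , v≢u

  fromDeleted : Σ V (_≢ u) → MV G u v
  fromDeleted (x , x≢u) with x ≟ v
  ... | yes _   = nothing
  ... | no x≢v  = just (x , x≢u , x≢v)

  toDeleted∘fromDeleted : ∀ x → toDeleted (fromDeleted x) ≡ x
  toDeleted∘fromDeleted (x , _) with x ≟ v
  ... | yes refl = refl
  ... | no _     = refl

  fromDeleted∘toDeleted : ∀ x → fromDeleted (toDeleted x) ≡ x
  fromDeleted∘toDeleted (just (x , _ , x≢v)) with x ≟ v
  ... | yes x≡v = contradiction x≡v x≢v
  ... | no _    = refl
  fromDeleted∘toDeleted nothing with v ≟ v
  ... | yes _   = refl
  ... | no v≢v  = contradiction refl v≢v

  magnetVertices⤖deleted : MV G u v ⤖ Σ V (_≢ u)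
  magnetVertices⤖deleted =
    ↔⇒⤖ (mk↔ₛ′ toDeleted fromDeleted toDeleted∘fromDeleted fromDeleted∘toDeleted)

  module _ (u≽v : Dominates G u v) where

    private
      commonNeighbour : ∀ {y} → y ≢ u → _~_ G v y → SetC G u v y
      commonNeighbour y≢u v~y = dominates⇒neighbour G u≽v y≢u v~y , v~y

    magnet≅delete : magnet G u v ≅ delete G u
    magnet≅delete = magnetVertices⤖deleted , adjacency
      where
      adjacency : ∀ x y → _~_ (magnet G u v) x y ⇔
                          _~_ (delete G u) (toDeleted x) (toDeleted y)
      adjacency (just _) (just _) = mk⇔ (λ x~y → x~y) (λ x~y → x~y)
      adjacency nothing (just (y , y≢u , _)) = mk⇔ proj₂ (commonNeighbour y≢u)
      adjacency (just (x , x≢u , _)) nothing =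
        mk⇔ (λ c → ~-sym G (proj₂ c)) (λ x~v → commonNeighbour x≢u (~-sym G x~v))
      adjacency nothing nothing = mk⇔ (λ ()) (λ v~v → ⊥-elim (~-irr G v~v))

lemma11 : (n : ℕ) (G : Graph (Fin n)) (k : ℤ) (I′ : Instance) →
          DomStep ⟨ Fin n , G , k ⟩ I′ →
          Σ Instance λ I″ → MagnetStep ⟨ Fin n , G , k ⟩ I″ ×
            (Instance.k I″ ≡ Instance.k I′) × (Instance.G I″ ≅ Instance.G I′)
lemma11 n G k _ (dom _ _ u v u~v u≽v) =
  _ , mag G k u v u~v (dominates⇒magnetCond G u≽v) , refl ,
  Merge.magnet≅delete _≟_ G (adjacent⇒≢ G u~v) u≽v
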